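{- Let $P$ be a Horn mca-program and let $M$ be a derivable model of $P$. Let $t^{P,M} = (X_n)_{n \geq 0}$ be defined by $X_0 = \emptyset$ and $X_{n+1} = \mathit{hset}(P(X_n)) \cap M$. Then $M = \bigcup_{n=0}^\infty X_n$.
   Context: Let $\mathit{At}$ be a set of propositional atoms. An mc-atom over $\mathit{At}$ is an expression $kX$, where $k$ is a non-negative integer and $X \subseteq \mathit{At}$ is finite with $k \leq |X|$; $\mathit{aset}(kX) = X$. An mc-literal is $A$ or $\mathbf{not}(A)$ for an mc-atom $A$. An mca-clause $r$ is an expression $H \leftarrow L_1, \ldots, L_m$ ($m \geq 0$), where $H$ is an mc-atom and the $L_i$ are mc-literals, with $\mathit{hd}(r) = H$, $\mathit{bd}(r) = \{L_1, \ldots, L_m\}$, and $\mathit{hset}(r) = \mathit{aset}(H)$. An mca-program is a set of mca-clauses. It is Horn if no clause body contains a literal of the form $\mathbf{not}(A)$. For a set $Q$ of clauses, $\mathit{hset}(Q) = \bigcup\{\mathit{hset}(r) : r \in Q\}$. Satisfaction, for $M \subseteq \mathit{At}$: - $M \models kX$ iff $|M \cap X| \geq k$. - $M \models \mathit{bd}(r)$ iff $M$ satisfies all literals of $\mathit{bd}(r)$. Operators, computations and derivable models: - $P(M) = \{r \in P : M \models \mathit{bd}(r)\}$. - $T^{\mathit{nd}}_P(M)$ is the set of all $M'$ with $M' \subseteq \mathit{hset}(P(M))$ and $M' \models \mathit{hd}(r)$ for all $r \in P(M)$. - A $P$-computation is a sequence $(X_n)_{n \geq 0}$ with $X_0 =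 \emptyset$ and, for all $n$, $X_n \subseteq X_{n+1}$ and $X_{n+1} \in T^{\mathit{nd}}_P(X_n)$. - Its result is $\bigcup_n X_n$. - A set $M$ is a derivable model of a Horn mca-program $P$ if $M$ is the result of some $P$-computation. -}

module Defs where

open import Data.Nat using (ℕ; zero; suc; _≤_)
open import Data.List using (List; length)
open import Data.List.Membership.Propositional using (_∈_)
open import Data.List.Relation.Unary.Unique.Propositional using (Unique)
open import Data.List.Relation.Unary.All using (All)
open import Data.Product using (Σ; ∃; ∃-syntax; _×_)
open import Data.Empty using (⊥)
open import Data.Unit using (⊤)
open import Relation.Binary.PropositionalEquality using (_≡_)
open import Relation.Nullary using (¬_)
open import Function.Bundles using (_⇔_)

Subset : Set → Set₁
Subset At = At → Set

record MCAtom (At : Set) : Set where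
  constructor mcatom
  field
    k     : ℕ
    X     : List At
    X-uniq : Unique X
    k≤∣X∣ : k ≤ length X

open MCAtom public

aset : {At : Set} → MCAtom At → Subset At
aset A a = a ∈ X A

data MCLit (At : Set) : Set where
  pos : MCAtom At → MCLit At
  not : MCAtom At → MCLit At

record Clause (At : Set) : Set where
  constructor _←_
  field
    hd : MCAtom At
    bd : List (MCLit At)

open Clause public

Program : Set → Set₁
Program At = Clause At → Set

IsPos : {At : Set} → MCLit At → Set
IsPos (pos _) = ⊤
IsPos (not _) = ⊥

Horn : {At : Set} → Program At → Set
Horn {At} P = (r : Clause At) → P r → All IsPos (bd r)

-- M ⊨ kX  iff  |M ∩ X| ≥ k, i.e. there are k distinct atoms of X lying in M.
_⊨ₐ_ : {At : Set} → Subset At → MCAtom At → Set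
_⊨ₐ_ {At} M A =
  Σ (List At) λ Y → Unique Y × (length Y ≡ k A) × All (λ y → y ∈ X A × M y) Y

_⊨ₗ_ : {At : Set} → Subset At → MCLit At → Set
M ⊨ₗ pos A = M ⊨ₐ A
M ⊨ₗ not A = ¬ (M ⊨ₐ A)

_⊨bd_ : {At : Set} → Subset At → Clause At → Set
M ⊨bd r = All (M ⊨ₗ_) (bd r)

_⟨_⟩ : {At : Set} → Program At → Subset At → Program At
(P ⟨ M ⟩) r = P r × (M ⊨bd r)

hset : {At : Set} → Program At → Subset At
hset {At} Q a = ∃[ r ] (Q r × a ∈ X (hd r))

_⊆_ : {At : Set} → Subset At → Subset At → Set
_⊆_ {At} A B = (a : At) → A a → B a

Tnd : {At : Set} → Program At → Subset At → Subset At → Set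
Tnd {At} P M M' =
  (M' ⊆ hset (P ⟨ M ⟩)) × ((r : Clause At) → (P ⟨ M ⟩) r → M' ⊨ₐ hd r)

∅ : {At : Set} → Subset At
∅ _ = ⊥

record Computation {At : Set} (P : Program At) : Set₁ where
  field
    seq   : ℕ → Subset At
    start : (a : At) → seq zero a ⇔ ∅ a
    incr  : (n : ℕ) → seq n ⊆ seq (suc n)
    step  : (n : ℕ) → Tnd P (seq n) (seq (suc n))

open Computation public

⋃ : {At : Set} → (ℕ → Subset At) → Subset At
⋃ Xs a = ∃[ n ] Xs n a

_≐_ : {At : Set} → Subset At → Subset At → Set
_≐_ {At} A B = (a : At) → A a ⇔ B a

DerivableModel : {At : Set} → Program At → Subset At → Set₁
DerivableModel P M = Σ (Computation P) λ c → ⋃ (seq c) ≐ M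

t : {At : Set} → Program At → Subset At → ℕ → Subset At
t P M zero      = ∅
t P M (suc n) a = hset (P ⟨ t P M n ⟩) a × M a

{-# OPTIONS --safe #-}
module Submission where

-- For a Horn program the body of a clause only contains positive mc-literals,
-- so P(·) and hence hset(P(·)) are monotone. Induction on n then shows that the
-- n-th stage of any P-computation with result M lies in the n-th stage of
-- t^{P,M}; conversely every stage of t^{P,M} is contained in M by construction.

open import Defs
open import Data.Nat using (ℕ; zero; suc)
open import Data.List using (List; []; _∷_)
open import Data.List.Relation.Unary.All using (All; []; _∷_)
import Data.List.Relation.Unary.All as All
open import Data.Product using (_×_; _,_; proj₁)
open import Data.Empty using (⊥-elim)
open import Function.Bundles using (mk⇔; Equivalence)

module _ {At : Set} where

  ⊨ₐ-mono : {M N : Subset At} → M ⊆ N → (A : MCAtom At) → M ⊨ₐ A → N ⊨ₐ A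
  ⊨ₐ-mono M⊆N A (Y , Y-uniq , ∣Y∣≡k , Y⊆X∩M) =
    Y , Y-uniq , ∣Y∣≡k , All.map (λ {y} (y∈X , My) → y∈X , M⊆N y My) Y⊆X∩M

  positive-⊨-mono : {M N : Subset At} → M ⊆ N → (ls : List (MCLit At)) →
    All IsPos ls → All (M ⊨ₗ_) ls → All (N ⊨ₗ_) ls
  positive-⊨-mono M⊆N []           []       []       = []
  positive-⊨-mono M⊆N (pos A ∷ ls) (_ ∷ ps) (h ∷ hs) =
    ⊨ₐ-mono M⊆N A h ∷ positive-⊨-mono M⊆N ls ps hs

  module _ {P : Program At} (horn : Horn P) where

    hset-⟨⟩-mono : {M N : Subset At} → M ⊆ N →
      hset (P ⟨ M ⟩) ⊆ hset (P ⟨ N ⟩)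
    hset-⟨⟩-mono M⊆N a (r , (Pr , M⊨bd) , a∈hd) =
      r , (Pr , positive-⊨-mono M⊆N (bd r) (horn r Pr) M⊨bd) , a∈hd

    computation⊆t : (c : Computation P) {M : Subset At} →
      (∀ n → seq c n ⊆ M) → ∀ n → seq c n ⊆ t P M n
    computation⊆t c seq⊆M zero    a a∈X₀ = ⊥-elim (Equivalence.to (start c a) a∈X₀)
    computation⊆t c seq⊆M (suc n) a a∈Xₙ₊₁ =
      hset-⟨⟩-mono (computation⊆t c seq⊆M n) a (proj₁ (step c n) a a∈Xₙ₊₁) ,
      seq⊆M (suc n) a a∈Xₙ₊₁

  t⊆M : (P : Program At) (M : Subset At) (n : ℕ) → t P M n ⊆ M
  t⊆M P M (suc n) a (_ , Ma) = Ma

proposition6 : {At : Set} (P : Program At) (M : Subset At) →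
    Horn P → DerivableModel P M → M ≐ ⋃ (t P M)
proposition6 P M horn (c , ⋃seq≐M) a = mk⇔
  (λ Ma → let (n , a∈Xₙ) = Equivalence.from (⋃seq≐M a) Ma
          in n , computation⊆t horn c seq⊆M n a a∈Xₙ)
  (λ (n , a∈tₙ) → t⊆M P M n a a∈tₙ)
  where
  seq⊆M : ∀ n → seq c n ⊆ M
  seq⊆M n a a∈Xₙ = Equivalence.to (⋃seq≐M a) (n , a∈Xₙ)
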